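{- Among any $12$ consecutive positive integers there is at least one Zumkeller number.
   Context: A positive integer $n$ is a Zumkeller number if the set of its positive divisors can be partitioned into two disjoint subsets with equal sums. -}

module Defs where

open import Data.Nat using (ℕ; zero; suc; _+_)
open import Data.Nat.Divisibility using (_∣?_)
open import Data.List using (List; []; _∷_; filter; upTo; map; length)
open import Data.Bool using (Bool; true; false)
open import Data.Product using (Σ; _×_)
open import Relation.Binary.PropositionalEquality using (_≡_)

divisors : ℕ → List ℕ
divisors n = filter (_∣? n) (map suc (upTo n))

-- A labelling is exactly a partition
-- of the (distinct) entries of xs into two disjoint subsets.
sumTrue : List ℕ → List Bool → ℕ
sumTrue []       _            = 0
sumTrue (x ∷ xs) []           = 0
sumTrue (x ∷ xs) (true ∷ ls)  = x + sumTrue xs ls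
sumTrue (x ∷ xs) (false ∷ ls) = sumTrue xs ls

sumFalse : List ℕ → List Bool → ℕ
sumFalse []       _            = 0
sumFalse (x ∷ xs) []           = 0
sumFalse (x ∷ xs) (true ∷ ls)  = sumFalse xs ls
sumFalse (x ∷ xs) (false ∷ ls) = x + sumFalse xs ls

Zumkeller : ℕ → Set
Zumkeller n = Σ (List Bool) λ ls →
  (length ls ≡ length (divisors n)) × (sumTrue (divisors n) ls ≡ sumFalse (divisors n) ls)

-- Among n, …, n + 11 there is a number 6j with 3 ∤ j, that is N = 3·2^a·m with a ≥ 1 and
-- gcd(m, 6) = 1.  Put on one side the divisors d of N with 3 ∣ d and 2^a ∣ d, together with
-- those with 3 ∤ d and 2 ∣ d but 2^a ∤ d.  Writing s = σ(m), they sum to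
-- 3·2^a·s + (2^a − 2)·s, which is half of σ(N) = 4·(2^(a+1) − 1)·s.
module Submission where

open import Defs
open import Data.Nat using (ℕ; zero; suc; _+_; _*_; _^_; _∸_; _≤_; _<_; _≥_; z≤n; s≤s; NonZero; ≢-nonZero; ≢-nonZero⁻¹; nonTrivial⇒≢1)
open import Data.Nat.Properties
open import Data.Nat.Divisibility
open import Data.Nat.Coprimality using (Coprime; coprime-divisor)
open import Data.Nat.Primality using (Prime; prime?; prime⇒irreducible; prime⇒nonZero; prime⇒nonTrivial; prime[2]; euclidsLemma)
open import Data.Nat.Induction using (<-rec)
open import Data.Nat.Tactic.RingSolver using (solve-∀)
open import Data.List using ([]; _∷_; filter; upTo; map; applyUpTo; _++_)
open import Data.Nat.ListAction using (sum)
open import Data.Nat.ListAction.Properties using (sum-++)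
open import Data.List.Properties using (applyUpTo-∷ʳ; map-applyUpTo; map-upTo; length-map)
open import Data.Bool using (Bool; true; false; not; _∧_; if_then_else_)
open import Data.Product using (Σ; ∃₂; _×_; _,_)
open import Data.Sum using (inj₁; inj₂; [_,_]′)
open import Data.Empty using (⊥-elim)
open import Function using (_∘_)
open import Relation.Nullary using (¬_; yes; no; does)
open import Relation.Nullary.Decidable using (dec-true; dec-false; from-yes; from-no)
open import Relation.Unary using (Pred; Decidable)
open import Level using (0ℓ)
open import Relation.Binary.PropositionalEquality
open ≡-Reasoning

infixl 6.2 _when_
_when_ : ℕ → Bool → ℕ
x when true  = x
x when false = 0

when-+ : ∀ b x y → (x + y) when b ≡ x when b + y when b
when-+ true  x y = refl
when-+ false x y = refl

when-* : ∀ b c x → (c * x) when b ≡ c * (x when b)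
when-* true  c x = refl
when-* false c x = sym (*-zeroʳ c)

0-when : ∀ b → 0 when b ≡ 0
0-when true  = refl
0-when false = refl

when-not : ∀ b x → x ≡ x when b + x when not b
when-not true  x = sym (+-identityʳ x)
when-not false x = refl

sumTo : ℕ → (ℕ → ℕ) → ℕ
sumTo zero    g = 0
sumTo (suc n) g = sumTo n g + g (suc n)

sumTo-cong : ∀ n {g h : ℕ → ℕ} → (∀ i → 0 < i → i ≤ n → g i ≡ h i) → sumTo n g ≡ sumTo n h
sumTo-cong zero    g≡h = refl
sumTo-cong (suc n) g≡h =
  cong₂ _+_ (sumTo-cong n (λ i 0<i i≤n → g≡h i 0<i (m≤n⇒m≤1+n i≤n))) (g≡h (suc n) (s≤s z≤n) ≤-refl)

sumTo-zero : ∀ n (g : ℕ → ℕ) → (∀ i → 0 < i → i ≤ n → g i ≡ 0) → sumTo n g ≡ 0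
sumTo-zero zero    g g≡0 = refl
sumTo-zero (suc n) g g≡0 =
  cong₂ _+_ (sumTo-zero n g (λ i 0<i i≤n → g≡0 i 0<i (m≤n⇒m≤1+n i≤n))) (g≡0 (suc n) (s≤s z≤n) ≤-refl)

sumTo-+ : ∀ n (g h : ℕ → ℕ) → sumTo n (λ i → g i + h i) ≡ sumTo n g + sumTo n h
sumTo-+ zero    g h = refl
sumTo-+ (suc n) g h = begin
  sumTo n (λ i → g i + h i) + (g (suc n) + h (suc n)) ≡⟨ cong (_+ (g (suc n) + h (suc n))) (sumTo-+ n g h) ⟩
  (sumTo n g + sumTo n h) + (g (suc n) + h (suc n))   ≡⟨ +-+-comm (sumTo n g) (sumTo n h) _ _ ⟩
  (sumTo n g + g (suc n)) + (sumTo n h + h (suc n))   ∎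
  where
  +-+-comm : ∀ a b c d → (a + b) + (c + d) ≡ (a + c) + (b + d)
  +-+-comm = solve-∀

sumTo-* : ∀ n c (g : ℕ → ℕ) → sumTo n (λ i → c * g i) ≡ c * sumTo n g
sumTo-* zero    c g = sym (*-zeroʳ c)
sumTo-* (suc n) c g =
  trans (cong (_+ c * g (suc n)) (sumTo-* n c g)) (sym (*-distribˡ-+ c (sumTo n g) (g (suc n))))

sumTo-split : ∀ a b (g : ℕ → ℕ) → sumTo (a + b) g ≡ sumTo a g + sumTo b (λ j → g (a + j))
sumTo-split a zero    g = trans (cong (λ x → sumTo x g) (+-identityʳ a)) (sym (+-identityʳ _))
sumTo-split a (suc b) g rewrite +-suc a b =
  trans (cong (_+ g (suc (a + b))) (sumTo-split a b g)) (+-assoc (sumTo a g) _ _)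

sumTo-multiples : ∀ c K (h : ℕ → ℕ) .{{_ : NonZero c}} → (∀ i → ¬ c ∣ i → h i ≡ 0) →
                  sumTo (c * K) h ≡ sumTo K (λ e → h (c * e))
sumTo-multiples c@(suc c′) zero    h h≡0 = cong (λ x → sumTo x h) (*-zeroʳ c′)
sumTo-multiples c@(suc c′) (suc K) h h≡0 = begin
  sumTo (c * suc K) h                           ≡⟨ cong (λ x → sumTo x h) (trans (*-suc c K) (+-comm c (c * K))) ⟩
  sumTo (c * K + c) h                           ≡⟨ sumTo-split (c * K) c h ⟩
  sumTo (c * K) h + sumTo c (λ j → h (c * K + j)) ≡⟨ cong₂ _+_ (sumTo-multiples c K h h≡0) lastBlock ⟩
  sumTo K (λ e → h (c * e)) + h (c * suc K)     ∎
  where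
  lastBlock : sumTo c (λ j → h (c * K + j)) ≡ h (c * suc K)
  lastBlock = cong₂ _+_
    (sumTo-zero c′ _ λ { (suc j) _ j<c → h≡0 _ λ c∣cK+j →
      1+n≰n (≤-trans (s≤s j<c) (∣⇒≤ (∣m+n∣m⇒∣n c∣cK+j (m∣m*n K)))) })
    (cong h (trans (+-comm (c * K) c) (sym (*-suc c K))))

infix 6.5 _∣ᵇ_
_∣ᵇ_ : ℕ → ℕ → Bool
c ∣ᵇ d = does (c ∣? d)

when-∣ᵇ : ∀ {c d} x → c ∣ d → x when c ∣ᵇ d ≡ x
when-∣ᵇ {c} {d} x c∣d = cong (x when_) (dec-true (c ∣? d) c∣d)

when-∤ᵇ : ∀ {c d} x → ¬ c ∣ d → x when c ∣ᵇ d ≡ 0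
when-∤ᵇ {c} {d} x c∤d = cong (x when_) (dec-false (c ∣? d) c∤d)

when-∣ᵇ-cong : ∀ {c d c′ d′} x → (c ∣ d → c′ ∣ d′) → (c′ ∣ d′ → c ∣ d) → x when c ∣ᵇ d ≡ x when c′ ∣ᵇ d′
when-∣ᵇ-cong {c} {d} {c′} {d′} x to from with c ∣? d | c′ ∣? d′
... | yes _   | yes _     = refl
... | no _    | no _      = refl
... | yes c∣d | no c′∤d′  = ⊥-elim (c′∤d′ (to c∣d))
... | no c∤d  | yes c′∣d′ = ⊥-elim (c∤d (from c′∣d′))

divisorSum : ℕ → (ℕ → ℕ) → ℕ
divisorSum N f = sumTo N (λ d → f d when d ∣ᵇ N)

σ : ℕ → ℕ
σ N = divisorSum N (λ d → d)

divisorSum-cong : ∀ N {f g : ℕ → ℕ} → (∀ d → d ∣ N → f d ≡ g d) → divisorSum N f ≡ divisorSum N g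
divisorSum-cong N {f} {g} f≡g = sumTo-cong N λ d _ _ → termwise d
  where
  termwise : ∀ d → f d when d ∣ᵇ N ≡ g d when d ∣ᵇ N
  termwise d with d ∣? N
  ... | yes d∣N = f≡g d d∣N
  ... | no _    = refl

divisorSum-+ : ∀ N (f g : ℕ → ℕ) → divisorSum N (λ d → f d + g d) ≡ divisorSum N f + divisorSum N g
divisorSum-+ N f g = trans (sumTo-cong N λ d _ _ → when-+ (d ∣ᵇ N) (f d) (g d)) (sumTo-+ N _ _)

divisorSum-* : ∀ N c (f : ℕ → ℕ) → divisorSum N (λ d → c * f d) ≡ c * divisorSum N f
divisorSum-* N c f = trans (sumTo-cong N λ d _ _ → when-* (d ∣ᵇ N) c (f d)) (sumTo-* N c _)

divisorSum-split : ∀ N (t : ℕ → Bool) (f : ℕ → ℕ) →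
                   divisorSum N f ≡ divisorSum N (λ d → f d when t d) + divisorSum N (λ d → f d when not (t d))
divisorSum-split N t f = trans (divisorSum-cong N λ d _ → when-not (t d) (f d)) (divisorSum-+ N _ _)

divisorSum-multiples : ∀ c K (f : ℕ → ℕ) .{{_ : NonZero c}} →
                       divisorSum (c * K) (λ d → f d when c ∣ᵇ d) ≡ divisorSum K (λ e → f (c * e))
divisorSum-multiples c K f = trans (sumTo-multiples c K term nonMultiple) (sumTo-cong K λ e _ _ → atMultiple e)
  where
  term : ℕ → ℕ
  term d = f d when c ∣ᵇ d when d ∣ᵇ c * K
  nonMultiple : ∀ d → ¬ c ∣ d → term d ≡ 0
  nonMultiple d c∤d = trans (cong (_when d ∣ᵇ c * K) (when-∤ᵇ (f d) c∤d)) (0-when _)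
  atMultiple : ∀ e → term (c * e) ≡ f (c * e) when e ∣ᵇ K
  atMultiple e = begin
    term (c * e)                          ≡⟨ cong (_when c * e ∣ᵇ c * K) (when-∣ᵇ {c} (f (c * e)) (m∣m*n e)) ⟩
    f (c * e) when c * e ∣ᵇ c * K         ≡⟨ when-∣ᵇ-cong (f (c * e)) (*-cancelˡ-∣ c) (*-monoʳ-∣ c) ⟩
    f (c * e) when e ∣ᵇ K                 ∎

divisorSum-restrict : ∀ N K (P : ℕ → Bool) (f : ℕ → ℕ) .{{_ : NonZero N}} → K ∣ N →
                      (∀ d → d ∣ N → P d ≡ true → d ∣ K) → (∀ d → d ∣ K → P d ≡ true) →
                      divisorSum N (λ d → f d when P d) ≡ divisorSum K f
divisorSum-restrict N K P f K∣N P⇒∣K ∣K⇒P = begin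
  sumTo N term                                        ≡⟨ cong (λ x → sumTo x term) (sym (m+[n∸m]≡n (∣⇒≤ K∣N))) ⟩
  sumTo (K + (N ∸ K)) term                            ≡⟨ sumTo-split K (N ∸ K) term ⟩
  sumTo K term + sumTo (N ∸ K) (λ j → term (K + j))    ≡⟨ cong₂ _+_ (sumTo-cong K λ d _ _ → upToK d)
                                                                   (sumTo-zero (N ∸ K) _ λ j 0<j _ → beyondK j 0<j) ⟩
  divisorSum K f + 0                                  ≡⟨ +-identityʳ _ ⟩
  divisorSum K f                                      ∎
  where
  instance
    K≢0 : NonZero K
    K≢0 = ≢-nonZero λ { refl → ≢-nonZero⁻¹ N (0∣⇒≡0 K∣N) }
  term : ℕ → ℕ
  term d = f d when P d when d ∣ᵇ N
  upToK : ∀ d → term d ≡ f d when d ∣ᵇ K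
  upToK d with d ∣? K | d ∣? N | P d in Pd
  ... | yes d∣K | yes _   | true  = refl
  ... | yes d∣K | yes _   | false with () ← trans (sym Pd) (∣K⇒P d d∣K)
  ... | yes d∣K | no d∤N  | _     = ⊥-elim (d∤N (∣-trans d∣K K∣N))
  ... | no d∤K  | yes d∣N | true  = ⊥-elim (d∤K (P⇒∣K d d∣N Pd))
  ... | no _    | yes _   | false = refl
  ... | no _    | no _    | _     = refl
  beyondK : ∀ j → 0 < j → term (K + j) ≡ 0
  beyondK j 0<j with (K + j) ∣? N | P (K + j) in Pd
  ... | yes d∣N | true  = ⊥-elim (<⇒≱ (m<m+n K 0<j) (∣⇒≤ (P⇒∣K (K + j) d∣N Pd)))
  ... | yes _   | false = refl
  ... | no _    | _     = refl

prime∤⇒coprime : ∀ {q d} → Prime q → ¬ q ∣ d → Coprime d q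
prime∤⇒coprime pq q∤d (i∣d , i∣q) with prime⇒irreducible pq i∣q
... | inj₁ i≡1 = i≡1
... | inj₂ refl = ⊥-elim (q∤d i∣d)

prime∤⇒∤^ : ∀ {q a} k → Prime q → ¬ q ∣ a → ¬ q ∣ a ^ k
prime∤⇒∤^ zero    pq q∤a q∣1 = nonTrivial⇒≢1 {{prime⇒nonTrivial pq}} (∣1⇒≡1 q∣1)
prime∤⇒∤^ {a = a} (suc k) pq q∤a q∣a^[1+k] with euclidsLemma a (a ^ k) pq q∣a^[1+k]
... | inj₁ q∣a   = q∤a q∣a
... | inj₂ q∣a^k = prime∤⇒∤^ k pq q∤a q∣a^k

∣q^k*m⇒∣m : ∀ {q d} k m → Prime q → ¬ q ∣ d → d ∣ q ^ k * m → d ∣ m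
∣q^k*m⇒∣m {q} {d} zero    m pq q∤d d∣q^k*m = subst (d ∣_) (*-identityˡ m) d∣q^k*m
∣q^k*m⇒∣m {q} {d} (suc k) m pq q∤d d∣q^k*m = ∣q^k*m⇒∣m k m pq q∤d
  (coprime-divisor (prime∤⇒coprime pq q∤d) (subst (d ∣_) (*-assoc q (q ^ k) m) d∣q^k*m))

not-∣ᵇ⇒∤ : ∀ {c d} → not (c ∣ᵇ d) ≡ true → ¬ c ∣ d
not-∣ᵇ⇒∤ {c} {d} c∤ᵇd c∣d with () ← trans (sym c∤ᵇd) (cong not (dec-true (c ∣? d) c∣d))

divisorSum-coprimePart : ∀ {q} k m (f : ℕ → ℕ) .{{_ : NonZero m}} → Prime q → ¬ q ∣ m →
                         divisorSum (q ^ k * m) (λ d → f d when not (q ∣ᵇ d)) ≡ divisorSum m f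
divisorSum-coprimePart {q} k m f pq q∤m =
  divisorSum-restrict (q ^ k * m) m (λ d → not (q ∣ᵇ d)) f {{q^k*m≢0}} (n∣m*n (q ^ k))
    (λ d d∣N q∤ᵇd → ∣q^k*m⇒∣m k m pq (not-∣ᵇ⇒∤ q∤ᵇd) d∣N)
    (λ d d∣m → cong not (dec-false (q ∣? d) λ q∣d → q∤m (∣-trans q∣d d∣m)))
  where
  q^k*m≢0 : NonZero (q ^ k * m)
  q^k*m≢0 = m*n≢0 (q ^ k) m {{m^n≢0 q k {{prime⇒nonZero pq}}}}

σ-prime^suc : ∀ {q} k m .{{_ : NonZero m}} → Prime q → ¬ q ∣ m → σ (q ^ suc k * m) ≡ q * σ (q ^ k * m) + σ m
σ-prime^suc {q} k m pq q∤m = begin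
  σ (q ^ suc k * m)                                                    ≡⟨ divisorSum-split (q ^ suc k * m) (q ∣ᵇ_) (λ d → d) ⟩
  divisorSum (q ^ suc k * m) (λ d → d when q ∣ᵇ d) + divisorSum (q ^ suc k * m) (λ d → d when not (q ∣ᵇ d))
    ≡⟨ cong₂ _+_ multiplesOfq (divisorSum-coprimePart (suc k) m (λ d → d) pq q∤m) ⟩
  q * σ (q ^ k * m) + σ m                                              ∎
  where
  instance
    q≢0 : NonZero q
    q≢0 = prime⇒nonZero pq
  multiplesOfq : divisorSum (q ^ suc k * m) (λ d → d when q ∣ᵇ d) ≡ q * σ (q ^ k * m)
  multiplesOfq = begin
    divisorSum (q ^ suc k * m) (λ d → d when q ∣ᵇ d)   ≡⟨ cong (λ x → divisorSum x (λ d → d when q ∣ᵇ d)) (*-assoc q (q ^ k) m) ⟩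
    divisorSum (q * (q ^ k * m)) (λ d → d when q ∣ᵇ d) ≡⟨ divisorSum-multiples q (q ^ k * m) (λ d → d) ⟩
    divisorSum (q ^ k * m) (λ e → q * e)               ≡⟨ divisorSum-* (q ^ k * m) q (λ e → e) ⟩
    q * σ (q ^ k * m)                                  ∎

σ-2^k*odd : ∀ k m .{{_ : NonZero m}} → ¬ 2 ∣ m → σ (2 ^ k * m) + σ m ≡ 2 ^ suc k * σ m
σ-2^k*odd zero    m 2∤m = trans (cong (λ x → σ x + σ m) (*-identityˡ m)) (double (σ m))
  where
  double : ∀ x → x + x ≡ 2 * x
  double = solve-∀
σ-2^k*odd (suc k) m 2∤m = begin
  σ (2 ^ suc k * m) + σ m                  ≡⟨ cong (_+ σ m) (σ-prime^suc k m prime[2] 2∤m) ⟩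
  (2 * σ (2 ^ k * m) + σ m) + σ m          ≡⟨ regroup (σ (2 ^ k * m)) (σ m) ⟩
  2 * (σ (2 ^ k * m) + σ m)                ≡⟨ cong (2 *_) (σ-2^k*odd k m 2∤m) ⟩
  2 * (2 ^ suc k * σ m)                    ≡⟨ *-assoc 2 (2 ^ suc k) (σ m) ⟨
  2 ^ suc (suc k) * σ m                    ∎
  where
  regroup : ∀ x y → (2 * x + y) + y ≡ 2 * (x + y)
  regroup = solve-∀

sumTrue-map : ∀ xs (t : ℕ → Bool) → sumTrue xs (map t xs) ≡ sum (map (λ x → x when t x) xs)
sumTrue-map []       t = refl
sumTrue-map (x ∷ xs) t with t x
... | true  = cong (x +_) (sumTrue-map xs t)
... | false = sumTrue-map xs t

sumFalse-map : ∀ xs (t : ℕ → Bool) → sumFalse xs (map t xs) ≡ sum (map (λ x → x when not (t x)) xs)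
sumFalse-map []       t = refl
sumFalse-map (x ∷ xs) t with t x
... | true  = sumFalse-map xs t
... | false = cong (x +_) (sumFalse-map xs t)

sum-map-filter : ∀ {P : Pred ℕ 0ℓ} (P? : Decidable P) (f : ℕ → ℕ) xs →
                 sum (map f (filter P? xs)) ≡ sum (map (λ x → f x when does (P? x)) xs)
sum-map-filter P? f []       = refl
sum-map-filter P? f (x ∷ xs) with P? x
... | yes _ = cong (f x +_) (sum-map-filter P? f xs)
... | no _  = sum-map-filter P? f xs

sum-map-upTo : ∀ n (g : ℕ → ℕ) → sum (map g (map suc (upTo n))) ≡ sumTo n g
sum-map-upTo n g = begin
  sum (map g (map suc (upTo n)))   ≡⟨ cong (sum ∘ map g) (map-upTo suc n) ⟩
  sum (map g (applyUpTo suc n))    ≡⟨ cong sum (map-applyUpTo suc g n) ⟩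
  sum (applyUpTo (g ∘ suc) n)      ≡⟨ sum-applyUpTo n ⟩
  sumTo n g                        ∎
  where
  sum-applyUpTo : ∀ n → sum (applyUpTo (g ∘ suc) n) ≡ sumTo n g
  sum-applyUpTo zero    = refl
  sum-applyUpTo (suc n) = begin
    sum (applyUpTo (g ∘ suc) (suc n))                 ≡⟨ cong sum (applyUpTo-∷ʳ (g ∘ suc) n) ⟨
    sum (applyUpTo (g ∘ suc) n ++ g (suc n) ∷ [])     ≡⟨ sum-++ (applyUpTo (g ∘ suc) n) _ ⟩
    sum (applyUpTo (g ∘ suc) n) + (g (suc n) + 0)     ≡⟨ cong₂ _+_ (sum-applyUpTo n) (+-identityʳ _) ⟩
    sumTo n g + g (suc n)                             ∎

sum-map-divisors : ∀ N (f : ℕ → ℕ) → sum (map f (divisors N)) ≡ divisorSum N f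
sum-map-divisors N f = trans (sum-map-filter (_∣? N) f (map suc (upTo N))) (sum-map-upTo N _)

labelling⇒zumkeller : ∀ N (t : ℕ → Bool) →
                      divisorSum N (λ d → d when t d) ≡ divisorSum N (λ d → d when not (t d)) → Zumkeller N
labelling⇒zumkeller N t balanced = map t (divisors N) , length-map t (divisors N) , (begin
  sumTrue (divisors N) (map t (divisors N))        ≡⟨ sumTrue-map (divisors N) t ⟩
  sum (map (λ d → d when t d) (divisors N))        ≡⟨ sum-map-divisors N _ ⟩
  divisorSum N (λ d → d when t d)                  ≡⟨ balanced ⟩
  divisorSum N (λ d → d when not (t d))            ≡⟨ sum-map-divisors N _ ⟨
  sum (map (λ d → d when not (t d)) (divisors N))  ≡⟨ sumFalse-map (divisors N) t ⟨
  sumFalse (divisors N) (map t (divisors N))       ∎)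

halfSum⇒zumkeller : ∀ N (t : ℕ → Bool) → 2 * divisorSum N (λ d → d when t d) ≡ σ N → Zumkeller N
halfSum⇒zumkeller N t half = labelling⇒zumkeller N t (+-cancelˡ-≡ T T F (begin
  T + T    ≡⟨ cong (T +_) (+-identityʳ T) ⟨
  2 * T    ≡⟨ half ⟩
  σ N      ≡⟨ divisorSum-split N t (λ d → d) ⟩
  T + F    ∎))
  where
  T F : ℕ
  T = divisorSum N (λ d → d when t d)
  F = divisorSum N (λ d → d when not (t d))

prime[3] : Prime 3
prime[3] = from-yes (prime? 3)

when-when : ∀ a b x → x when a when b ≡ x when (a ∧ b)
when-when true  b     x = refl
when-when false true  x = refl
when-when false false x = refl

if-when-true : ∀ c u v x → x when (if c then u else v) when c ≡ x when u when c
if-when-true true  u v x = refl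
if-when-true false u v x = refl

if-when-false : ∀ c u v x → x when (if c then u else v) when not c ≡ x when v when not c
if-when-false true  u v x = refl
if-when-false false u v x = refl

module Halving (b : ℕ) {m : ℕ} (2∤m : ¬ 2 ∣ m) (3∤m : ¬ 3 ∣ m) where

  p M s : ℕ
  p = 2 ^ suc b
  M = p * m
  s = σ m

  instance
    m≢0 : NonZero m
    m≢0 = ≢-nonZero λ { refl → 2∤m (2 ∣0) }
    p≢0 : NonZero p
    p≢0 = m^n≢0 2 (suc b)
    M≢0 : NonZero M
    M≢0 = m*n≢0 p m

  halving : ℕ → Bool
  halving d = if 3 ∣ᵇ d then p ∣ᵇ d else (2 ∣ᵇ d ∧ not (p ∣ᵇ d))

  middleSum : ℕ
  middleSum = divisorSum M (λ d → d when (2 ∣ᵇ d ∧ not (p ∣ᵇ d)))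

  3∤p : ¬ 3 ∣ p
  3∤p = prime∤⇒∤^ (suc b) prime[3] (from-no (3 ∣? 2))

  3∤M : ¬ 3 ∣ M
  3∤M 3∣M = [ 3∤p , 3∤m ]′ (euclidsLemma p m prime[3] 3∣M)

  σ-3*M : σ (3 * M) ≡ 4 * σ M
  σ-3*M = begin
    σ (3 * M)             ≡⟨ σ-prime^suc 0 M prime[3] 3∤M ⟩
    3 * σ (1 * M) + σ M   ≡⟨ cong (λ x → 3 * σ x + σ M) (*-identityˡ M) ⟩
    3 * σ M + σ M         ≡⟨ +-comm (3 * σ M) (σ M) ⟩
    4 * σ M               ∎

  σ-M : σ M + s ≡ 2 * (p * s)
  σ-M = trans (σ-2^k*odd (suc b) m 2∤m) (*-assoc 2 p s)

  σ-M/2 : σ (2 ^ b * m) + s ≡ p * s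
  σ-M/2 = σ-2^k*odd b m 2∤m

  multiplesOfp : divisorSum M (λ d → d when p ∣ᵇ d) ≡ p * s
  multiplesOfp = trans (divisorSum-multiples p m (λ d → d)) (divisorSum-* m p (λ e → e))

  middleSum+multiplesOfp : middleSum + p * s ≡ 2 * σ (2 ^ b * m)
  middleSum+multiplesOfp = begin
    middleSum + p * s                                            ≡⟨ cong₂ _+_ evenNonMultiples evenMultiples ⟨
    divisorSum M (λ d → d when 2 ∣ᵇ d when not (p ∣ᵇ d)) + divisorSum M (λ d → d when 2 ∣ᵇ d when p ∣ᵇ d)
                                                                 ≡⟨ +-comm (divisorSum M _) _ ⟩
    divisorSum M (λ d → d when 2 ∣ᵇ d when p ∣ᵇ d) + divisorSum M (λ d → d when 2 ∣ᵇ d when not (p ∣ᵇ d))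
                                                                 ≡⟨ divisorSum-split M (p ∣ᵇ_) (λ d → d when 2 ∣ᵇ d) ⟨
    divisorSum M (λ d → d when 2 ∣ᵇ d)                           ≡⟨ cong (λ x → divisorSum x (λ d → d when 2 ∣ᵇ d)) (*-assoc 2 (2 ^ b) m) ⟩
    divisorSum (2 * (2 ^ b * m)) (λ d → d when 2 ∣ᵇ d)           ≡⟨ divisorSum-multiples 2 (2 ^ b * m) (λ d → d) ⟩
    divisorSum (2 ^ b * m) (λ e → 2 * e)                         ≡⟨ divisorSum-* (2 ^ b * m) 2 (λ e → e) ⟩
    2 * σ (2 ^ b * m)                                            ∎
    where
    evenNonMultiples : divisorSum M (λ d → d when 2 ∣ᵇ d when not (p ∣ᵇ d)) ≡ middleSum
    evenNonMultiples = divisorSum-cong M λ d _ → when-when (2 ∣ᵇ d) (not (p ∣ᵇ d)) d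
    multipleOfp⇒even : ∀ d → d when 2 ∣ᵇ d when p ∣ᵇ d ≡ d when p ∣ᵇ d
    multipleOfp⇒even d with p ∣? d
    ... | yes p∣d = when-∣ᵇ d (∣-trans (m∣m*n (2 ^ b)) p∣d)
    ... | no _    = refl
    evenMultiples : divisorSum M (λ d → d when 2 ∣ᵇ d when p ∣ᵇ d) ≡ p * s
    evenMultiples = trans (divisorSum-cong M λ d _ → multipleOfp⇒even d) multiplesOfp

  halvingSum : divisorSum (3 * M) (λ d → d when halving d) ≡ 3 * (p * s) + middleSum
  halvingSum = begin
    divisorSum (3 * M) (λ d → d when halving d)
      ≡⟨ divisorSum-split (3 * M) (3 ∣ᵇ_) (λ d → d when halving d) ⟩
    divisorSum (3 * M) (λ d → d when halving d when 3 ∣ᵇ d) + divisorSum (3 * M) (λ d → d when halving d when not (3 ∣ᵇ d))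
      ≡⟨ cong₂ _+_ multiplesOf3 coprimeTo3 ⟩
    3 * (p * s) + middleSum
      ∎
    where
    multiplesOf3 : divisorSum (3 * M) (λ d → d when halving d when 3 ∣ᵇ d) ≡ 3 * (p * s)
    multiplesOf3 = begin
      divisorSum (3 * M) (λ d → d when halving d when 3 ∣ᵇ d) ≡⟨ divisorSum-cong (3 * M) (λ d _ → if-when-true (3 ∣ᵇ d) _ _ d) ⟩
      divisorSum (3 * M) (λ d → d when p ∣ᵇ d when 3 ∣ᵇ d)    ≡⟨ divisorSum-multiples 3 M (λ d → d when p ∣ᵇ d) ⟩
      divisorSum M (λ e → 3 * e when p ∣ᵇ 3 * e)              ≡⟨ divisorSum-cong M (λ e _ → p∣3*e⇔p∣e e) ⟩
      divisorSum M (λ e → 3 * (e when p ∣ᵇ e))                ≡⟨ divisorSum-* M 3 (λ e → e when p ∣ᵇ e) ⟩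
      3 * divisorSum M (λ e → e when p ∣ᵇ e)                  ≡⟨ cong (3 *_) multiplesOfp ⟩
      3 * (p * s)                                             ∎
      where
      p∣3*e⇔p∣e : ∀ e → 3 * e when p ∣ᵇ 3 * e ≡ 3 * (e when p ∣ᵇ e)
      p∣3*e⇔p∣e e = trans (when-∣ᵇ-cong (3 * e) (coprime-divisor (prime∤⇒coprime prime[3] 3∤p)) (∣n⇒∣m*n 3))
                          (when-* (p ∣ᵇ e) 3 e)
    coprimeTo3 : divisorSum (3 * M) (λ d → d when halving d when not (3 ∣ᵇ d)) ≡ middleSum
    coprimeTo3 = trans (divisorSum-cong (3 * M) (λ d _ → if-when-false (3 ∣ᵇ d) _ _ d))
                       (divisorSum-coprimePart 1 M _ prime[3] 3∤M)

  doubleHalvingSum : 2 * divisorSum (3 * M) (λ d → d when halving d) ≡ σ (3 * M)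
  -- Both sides are shifted by 4s + 2P so that no subtraction is needed.
  doubleHalvingSum = +-cancelʳ-≡ (4 * s + 2 * P) _ _ (begin
    2 * T + (4 * s + 2 * P)                   ≡⟨ cong (λ x → 2 * x + (4 * s + 2 * P)) halvingSum ⟩
    2 * (3 * P + middleSum) + (4 * s + 2 * P) ≡⟨ r₁ P middleSum s ⟩
    6 * P + 2 * (middleSum + P) + 4 * s       ≡⟨ cong (λ x → 6 * P + 2 * x + 4 * s) middleSum+multiplesOfp ⟩
    6 * P + 2 * (2 * Y) + 4 * s               ≡⟨ r₂ P Y s ⟩
    6 * P + 4 * (Y + s)                       ≡⟨ cong (λ x → 6 * P + 4 * x) σ-M/2 ⟩
    6 * P + 4 * P                             ≡⟨ r₃ P ⟩
    4 * (2 * P) + 2 * P                       ≡⟨ cong (λ x → 4 * x + 2 * P) σ-M ⟨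
    4 * (σ M + s) + 2 * P                     ≡⟨ r₄ (σ M) s P ⟩
    4 * σ M + (4 * s + 2 * P)                 ≡⟨ cong (_+ (4 * s + 2 * P)) σ-3*M ⟨
    σ (3 * M) + (4 * s + 2 * P)               ∎)
    where
    P Y T : ℕ
    P = p * s
    Y = σ (2 ^ b * m)
    T = divisorSum (3 * M) (λ d → d when halving d)
    r₁ : ∀ P T₂ s → 2 * (3 * P + T₂) + (4 * s + 2 * P) ≡ 6 * P + 2 * (T₂ + P) + 4 * s
    r₁ = solve-∀
    r₂ : ∀ P Y s → 6 * P + 2 * (2 * Y) + 4 * s ≡ 6 * P + 4 * (Y + s)
    r₂ = solve-∀
    r₃ : ∀ P → 6 * P + 4 * P ≡ 4 * (2 * P) + 2 * P
    r₃ = solve-∀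
    r₄ : ∀ x s P → 4 * (x + s) + 2 * P ≡ 4 * x + (4 * s + 2 * P)
    r₄ = solve-∀

  zumkeller : Zumkeller (3 * M)
  zumkeller = halfSum⇒zumkeller (3 * M) halving doubleHalvingSum

twoAdic : ∀ j → 0 < j → ∃₂ λ b m → j ≡ 2 ^ b * m × ¬ 2 ∣ m
twoAdic = <-rec (λ j → 0 < j → ∃₂ λ b m → j ≡ 2 ^ b * m × ¬ 2 ∣ m) decompose
  where
  decompose : ∀ j → (∀ {i} → i < j → 0 < i → ∃₂ λ b m → i ≡ 2 ^ b * m × ¬ 2 ∣ m) →
              0 < j → ∃₂ λ b m → j ≡ 2 ^ b * m × ¬ 2 ∣ m
  decompose j rec 0<j with 2 ∣? j
  ... | no 2∤j                        = 0 , j , sym (*-identityˡ j) , 2∤j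
  ... | yes (divides (suc i) refl) with rec (m<m*n (suc i) 2 ≤-refl) (s≤s z≤n)
  ...   | b , m , 1+i≡2^b*m , 2∤m     = suc b , m , trans (cong (_* 2) 1+i≡2^b*m) (shift (2 ^ b) m) , 2∤m
    where
    shift : ∀ x m → x * m * 2 ≡ 2 * x * m
    shift = solve-∀

nextMultipleOf6 : ∀ n → ∃₂ λ j k → k ≤ 5 × 6 * j ≡ n + k
nextMultipleOf6 zero = 0 , 0 , z≤n , refl
nextMultipleOf6 (suc n) with nextMultipleOf6 n
... | j , zero    , _         , 6j≡n+0   = suc j , 5 , ≤-refl , (begin
  6 * suc j        ≡⟨ *-suc 6 j ⟩
  6 + 6 * j        ≡⟨ cong (6 +_) 6j≡n+0 ⟩
  6 + (n + 0)      ≡⟨ shift n ⟩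
  suc n + 5        ∎)
  where
  shift : ∀ n → 6 + (n + 0) ≡ suc n + 5
  shift = solve-∀
... | j , suc k   , s≤s k≤4   , 6j≡n+1+k = j , k , m≤n⇒m≤1+n k≤4 , trans 6j≡n+1+k (+-suc n k)

6*-zumkeller : ∀ j → 0 < j → ¬ 3 ∣ j → Zumkeller (6 * j)
6*-zumkeller j 0<j 3∤j with twoAdic j 0<j
... | b , m , refl , 2∤m = subst Zumkeller (regroup (2 ^ b) m) (Halving.zumkeller b 2∤m (3∤j ∘ ∣n⇒∣m*n (2 ^ b)))
  where
  regroup : ∀ x m → 3 * (2 * x * m) ≡ 6 * (x * m)
  regroup = solve-∀

mainTheorem16 : (n : ℕ) → n ≥ 1 → Σ ℕ λ k → (k < 12) × Zumkeller (n + k)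
mainTheorem16 n n≥1 with nextMultipleOf6 n
... | j , k , k≤5 , 6j≡n+k with 3 ∣? j
...   | no 3∤j = k , ≤-trans (s≤s k≤5) (m≤m+n 6 6) , subst Zumkeller 6j≡n+k (6*-zumkeller j 0<j 3∤j)
  where
  0<j : 0 < j
  0<j = *-cancelˡ-< 6 0 j (subst (0 <_) (sym 6j≡n+k) (≤-trans n≥1 (m≤m+n n k)))
...   | yes 3∣j = k + 6 , +-monoˡ-≤ 6 (s≤s k≤5) , subst Zumkeller 6[1+j]≡n+k+6 (6*-zumkeller (suc j) (s≤s z≤n) 3∤1+j)
  where
  3∤1+j : ¬ 3 ∣ suc j
  3∤1+j 3∣1+j = from-no (3 ∣? 1) (∣m+n∣m⇒∣n (subst (3 ∣_) (+-comm 1 j) 3∣1+j) 3∣j)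
  6[1+j]≡n+k+6 : 6 * suc j ≡ n + (k + 6)
  6[1+j]≡n+k+6 = begin
    6 * suc j     ≡⟨ *-suc 6 j ⟩
    6 + 6 * j     ≡⟨ cong (6 +_) 6j≡n+k ⟩
    6 + (n + k)   ≡⟨ shift n k ⟩
    n + (k + 6)   ∎
    where
    shift : ∀ n k → 6 + (n + k) ≡ n + (k + 6)
    shift = solve-∀
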